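{- A binary matrix $A$ has at most one base that spans all other bases of $A$, with respect to the binary setting, and likewise with respect to the boolean setting.
   Context: A binary matrix has entries in $\{0,1\}$. A set $X$ of binary vectors spans a set $Y$ in the binary (resp. boolean) setting if every vector of $Y$ is a linear combination of vectors of $X$ with coefficients in $\{0,1\}$ using ordinary (resp. boolean, $1+1=1$) addition. A base of an $n\times m$ binary matrix $A$ is a set of vectors in $\{0,1\}^n$ spanning all columns of $A$, of minimum cardinality among all such spanning sets. -}

module Defs where

open import Data.Bool using (Bool; true; false; _∧_; _∨_)
open import Data.Nat using (ℕ; _+_; _*_; _≤_)
open import Data.Fin using (Fin; zero; suc)
open import Data.Vec using (Vec; replicate; zipWith; map)
open import Data.List using (List; []; _∷_; length)
open import Data.List.Membership.Propositional using (_∈_)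
open import Data.List.Relation.Unary.Unique.Propositional using (Unique)
open import Data.Product using (Σ; _×_)
open import Relation.Binary.PropositionalEquality using (_≡_)

-- The two settings: binary (ordinary addition over ℕ) and boolean (1+1=1).
data Setting : Set where
  binary boolean : Setting

b2n : Bool → ℕ
b2n false = 0
b2n true  = 1

binSum : ∀ {n} (xs : List (Vec Bool n)) → (Fin (length xs) → Bool) → Vec ℕ n
binSum {n} []       c = replicate n 0
binSum     (x ∷ xs) c =
  zipWith _+_ (map (λ b → b2n (c zero) * b2n b) x) (binSum xs (λ i → c (suc i)))

boolSum : ∀ {n} (xs : List (Vec Bool n)) → (Fin (length xs) → Bool) → Vec Bool n
boolSum {n} []       c = replicate n false
boolSum     (x ∷ xs) c =
  zipWith _∨_ (map (λ b → c zero ∧ b) x) (boolSum xs (λ i → c (suc i)))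

InSpan : ∀ {n} → Setting → List (Vec Bool n) → Vec Bool n → Set
InSpan binary  xs y = Σ (Fin (length xs) → Bool) λ c → binSum xs c ≡ map b2n y
InSpan boolean xs y = Σ (Fin (length xs) → Bool) λ c → boolSum xs c ≡ y

-- A finite set of vectors is represented by a duplicate-free list; its
-- cardinality is the length of the list.
-- X spans Y in setting s
Spans : ∀ {n} → Setting → List (Vec Bool n) → List (Vec Bool n) → Set
Spans s X Y = ∀ {y} → y ∈ Y → InSpan s X y

-- X spans all columns of the n×m binary matrix A (given by its columns)
SpansColumns : ∀ {n m} → Setting → (Fin m → Vec Bool n) → List (Vec Bool n) → Set
SpansColumns s A X = ∀ j → InSpan s X (A j)

IsBase : ∀ {n m} → Setting → (Fin m → Vec Bool n) → List (Vec Bool n) → Set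
IsBase {n} s A B =
  Unique B × SpansColumns s A B ×
  (∀ (X : List (Vec Bool n)) → Unique X → SpansColumns s A X → length B ≤ length X)

SpansAllBases : ∀ {n m} → Setting → (Fin m → Vec Bool n) → List (Vec Bool n) → Set
SpansAllBases {n} s A B =
  IsBase s A B × (∀ (B' : List (Vec Bool n)) → IsBase s A B' → Spans s B B')

-- Let B₁ and B₂ both span all bases, and suppose some a ∈ B₁ is missing from B₂.
-- Since B₂ spans B₁ and B₁ spans B₂, composing the two spans writes a as a
-- combination D of vectors of B₁.  Every vector used in a combination lies below
-- its target coordinatewise, so D cannot use a itself: otherwise some b ∈ B₂
-- would satisfy a ≤ b ≤ a.  Substituting D for a in the combinations of the
-- columns shows that B₁ without a still spans all columns, contradicting the
-- minimality of the base B₁.  In the binary setting one also has to check that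
-- all combinations stay inside {0,1}, i.e. never add two 1s in one coordinate.
module Submission where

open import Defs
open import Data.Bool using (Bool; true; false; T; _∧_; _∨_; if_then_else_)
open import Data.Bool.Properties
  using (T-∧; T-∨; ∧-zeroʳ; ∨-identityʳ; ∧-distribʳ-∨) renaming (_≟_ to _≟ᵇ_)
open import Data.Nat using (ℕ; _+_; _*_; _≤_; z≤n; s≤s)
open import Data.Nat.Properties using (≤-trans; ≤-pred; m≤n+m; <⇒≱)
open import Data.Fin using (Fin; zero; suc)
open import Data.Vec using (Vec; lookup; map; zipWith; tabulate)
open import Data.Vec.Properties
  using (≡-dec; lookup-map; lookup-zipWith; lookup-replicate; tabulate∘lookup; tabulate-cong)
open import Data.Bool.ListAction using (any)
open import Data.List using (List; []; _∷_; length; filter) renaming (lookup to lookupˡ)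
open import Data.List.Membership.Propositional using (_∈_; find; lose)
open import Data.List.Membership.Propositional.Properties using (∈-filter⁻; ∈-lookup)
open import Data.List.Properties using (filter-notAll)
open import Data.List.Relation.Unary.Any using (here; there)
open import Data.List.Relation.Unary.Any.Properties using (any⁺; any⁻)
open import Data.List.Relation.Unary.All as All using ()
open import Data.List.Relation.Unary.AllPairs using (_∷_)
open import Data.List.Relation.Unary.Unique.Propositional using (Unique)
open import Data.List.Relation.Unary.Unique.Propositional.Properties using (filter⁺)
open import Data.Product using (Σ; ∃; _×_; _,_; proj₁; proj₂)
open import Data.Sum using (inj₁; inj₂)
open import Data.Unit using (⊤; tt)
open import Data.Empty using (⊥; ⊥-elim)
open import Function using (_∘_; id)
open import Function.Bundles using (Equivalence)
open import Relation.Nullary using (¬_; ¬?; Dec; yes; no; does)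
open import Relation.Nullary.Decidable using (decidable-stable)
open import Relation.Binary.PropositionalEquality
  using (_≡_; _≢_; refl; sym; trans; cong; cong₂; subst; module ≡-Reasoning)

open Equivalence using (to; from)
open ≡-Reasoning

T-ext : ∀ {p q} → (T p → T q) → (T q → T p) → p ≡ q
T-ext {false} {false} _   _   = refl
T-ext {false} {true}  _   q⇒p = ⊥-elim (q⇒p tt)
T-ext {true}  {false} p⇒q _   = ⊥-elim (p⇒q tt)
T-ext {true}  {true}  _   _   = refl

¬T⇒≡false : ∀ {b} → ¬ T b → b ≡ false
¬T⇒≡false {false} _  = refl
¬T⇒≡false {true}  ¬b = ⊥-elim (¬b tt)

b2n-∧ : ∀ p q → b2n p * b2n q ≡ b2n (p ∧ q)
b2n-∧ false _     = refl
b2n-∧ true  false = refl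
b2n-∧ true  true  = refl

b2n-injective : ∀ {p q} → b2n p ≡ b2n q → p ≡ q
b2n-injective {false} {false} _ = refl
b2n-injective {true}  {true}  _ = refl

b2n≤1 : ∀ b → b2n b ≤ 1
b2n≤1 false = z≤n
b2n≤1 true  = s≤s z≤n

T⇒b2n≡1 : ∀ {b} → T b → b2n b ≡ 1
T⇒b2n≡1 {true} _ = refl

lookup-ext : ∀ {A : Set} {k} {u v : Vec A k} → (∀ i → lookup u i ≡ lookup v i) → u ≡ v
lookup-ext {u = u} {v} h = begin
  u                  ≡⟨ tabulate∘lookup u ⟨
  tabulate (lookup u) ≡⟨ tabulate-cong h ⟩
  tabulate (lookup v) ≡⟨ tabulate∘lookup v ⟩
  v                  ∎

module _ {A : Set} where

  any-intro : ∀ (t : A → Bool) {L x} → x ∈ L → T (t x) → T (any t L)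
  any-intro t x∈L tx = any⁺ t (lose x∈L tx)

  any-elim : ∀ (t : A → Bool) L → T (any t L) → ∃ λ x → x ∈ L × T (t x)
  any-elim t L p = find (any⁻ t L p)

  any-false : ∀ (t : A → Bool) {L x} → any t L ≡ false → x ∈ L → ¬ T (t x)
  any-false t eq x∈L tx = subst T eq (any-intro t x∈L tx)

  any-cong : ∀ {t t′ : A → Bool} L → (∀ {x} → x ∈ L → t x ≡ t′ x) → any t L ≡ any t′ L
  any-cong []      _ = refl
  any-cong (x ∷ L) h = cong₂ _∨_ (h (here refl)) (any-cong L (h ∘ there))

  count : (A → Bool) → List A → ℕ
  count t []      = 0
  count t (x ∷ L) = b2n (t x) + count t L

  count-pos : ∀ {t : A → Bool} {L x} → x ∈ L → T (t x) → 1 ≤ count t L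
  count-pos {t} (here refl) tx rewrite T⇒b2n≡1 tx = s≤s z≤n
  count-pos {t} {y ∷ L} (there x∈L) tx = ≤-trans (count-pos x∈L tx) (m≤n+m _ (b2n (t y)))

  -- In the binary setting, a 0/1 combination whose ordinary sum is again a 0/1
  -- vector selects, in each coordinate, at most one vector having a 1 there.
  AtMostOne : Setting → List A → (A → Bool) → Set
  AtMostOne binary  L t = ∀ {x x′} → x ∈ L → x′ ∈ L → T (t x) → T (t x′) → x ≡ x′
  AtMostOne boolean L t = ⊤

  AtMostOne-mono : ∀ s {L L′} {t t′ : A → Bool} → (∀ {x} → x ∈ L′ → x ∈ L) →
                   (∀ {x} → x ∈ L′ → T (t′ x) → T (t x)) → AtMostOne s L t → AtMostOne s L′ t′
  AtMostOne-mono binary  L′⊆L t′⇒t amo x∈ x′∈ tx tx′ =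
    amo (L′⊆L x∈) (L′⊆L x′∈) (t′⇒t x∈ tx) (t′⇒t x′∈ tx′)
  AtMostOne-mono boolean _    _    _                = tt

  count≤1⇒AtMostOne : ∀ {t : A → Bool} L → count t L ≤ 1 → AtMostOne binary L t
  count≤1⇒AtMostOne (y ∷ L) _  (here refl)  (here refl)  _  _   = refl
  count≤1⇒AtMostOne (y ∷ L) le (here refl)  (there x′∈L) ty tx′ =
    ⊥-elim (<⇒≱ (count-pos x′∈L tx′) (≤-pred (subst (λ k → k + _ ≤ 1) (T⇒b2n≡1 ty) le)))
  count≤1⇒AtMostOne (y ∷ L) le (there x∈L) (here refl)   tx ty =
    ⊥-elim (<⇒≱ (count-pos x∈L tx) (≤-pred (subst (λ k → k + _ ≤ 1) (T⇒b2n≡1 ty) le)))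
  count≤1⇒AtMostOne {t} (y ∷ L) le (there x∈L) (there x′∈L) =
    count≤1⇒AtMostOne L (≤-trans (m≤n+m _ (b2n (t y))) le) x∈L x′∈L

  AtMostOne⇒count≡b2n-any : ∀ {t : A → Bool} {L} → Unique L → AtMostOne binary L t →
                             count t L ≡ b2n (any t L)
  AtMostOne⇒count≡b2n-any {L = []} _ _ = refl
  AtMostOne⇒count≡b2n-any {t} {y ∷ L} (y∉L ∷ unique) amo with t y in ty
  ... | false = AtMostOne⇒count≡b2n-any unique λ x∈ x′∈ → amo (there x∈) (there x′∈)
  ... | true  = cong (1 +_) (begin
    count t L      ≡⟨ AtMostOne⇒count≡b2n-any unique (λ x∈ x′∈ → amo (there x∈) (there x′∈)) ⟩
    b2n (any t L)  ≡⟨ cong b2n (¬T⇒≡false others-unselected) ⟩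
    0              ∎)
    where
    others-unselected : ¬ T (any t L)
    others-unselected p with any-elim t L p
    ... | x , x∈L , tx = All.lookup y∉L x∈L (amo (here refl) (there x∈L) (subst T (sym ty) tt) tx)

module _ {n : ℕ} where
  private
    V : Set
    V = Vec Bool n

  _≟_ : (u v : V) → Dec (u ≡ v)
  _≟_ = ≡-dec _≟ᵇ_

  open import Data.List.Membership.DecPropositional _≟_ using (_∈?_)

  support-antisym : ∀ {u v : V} → (∀ i → T (lookup u i) → T (lookup v i)) →
                    (∀ i → T (lookup v i) → T (lookup u i)) → u ≡ v
  support-antisym u⊆v v⊆u = lookup-ext λ i → T-ext (u⊆v i) (v⊆u i)

  without : V → List V → List V
  without a = filter (λ x → ¬? (x ≟ a))

  any-without : ∀ {a} L {t : V → Bool} → t a ≡ false → any t (without a L) ≡ any t L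
  any-without []      _  = refl
  any-without {a} (x ∷ L) {t} ta with x ≟ a
  ... | yes refl rewrite ta = any-without L ta
  ... | no  _    = cong (t x ∨_) (any-without L ta)

  -- Coefficients are indexed by vectors rather than by positions in the list,
  -- so that they can be composed across different lists of vectors.
  selected : (V → Bool) → Fin n → V → Bool
  selected f i x = f x ∧ lookup x i

  record Represents (s : Setting) (L : List V) (f : V → Bool) (y : V) : Set where
    field
      covers    : ∀ i → any (selected f i) L ≡ lookup y i
      atMostOne : ∀ i → AtMostOne s L (selected f i)

  open Represents

  selected-below : ∀ {s L f y x} → Represents s L f y → ∀ i → x ∈ L → T (f x) →
                   T (lookup x i) → T (lookup y i)
  selected-below {f = f} rep i x∈L fx xᵢ =
    subst T (rep .covers i) (any-intro (selected f i) x∈L (from T-∧ (fx , xᵢ)))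

  lookup-binSum : ∀ L (f : V → Bool) i →
                  lookup (binSum L (f ∘ lookupˡ L)) i ≡ count (selected f i) L
  lookup-binSum []      f i = lookup-replicate i 0
  lookup-binSum (x ∷ L) f i =
    trans (lookup-zipWith _+_ i (map (λ b → b2n (f x) * b2n b) x) (binSum L (f ∘ lookupˡ L)))
          (cong₂ _+_ (trans (lookup-map i _ x) (b2n-∧ (f x) (lookup x i))) (lookup-binSum L f i))

  lookup-boolSum : ∀ L (f : V → Bool) i →
                   lookup (boolSum L (f ∘ lookupˡ L)) i ≡ any (selected f i) L
  lookup-boolSum []      f i = lookup-replicate i false
  lookup-boolSum (x ∷ L) f i =
    trans (lookup-zipWith _∨_ i (map (λ b → f x ∧ b) x) (boolSum L (f ∘ lookupˡ L)))
          (cong₂ _∨_ (lookup-map i _ x) (lookup-boolSum L f i))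

  binSum-cong : ∀ (L : List V) {c c′ : Fin (length L) → Bool} →
                (∀ j → c j ≡ c′ j) → binSum L c ≡ binSum L c′
  binSum-cong []      _ = refl
  binSum-cong (x ∷ L) h =
    cong₂ (λ b → zipWith _+_ (map (λ b′ → b2n b * b2n b′) x)) (h zero) (binSum-cong L (h ∘ suc))

  boolSum-cong : ∀ (L : List V) {c c′ : Fin (length L) → Bool} →
                 (∀ j → c j ≡ c′ j) → boolSum L c ≡ boolSum L c′
  boolSum-cong []      _ = refl
  boolSum-cong (x ∷ L) h =
    cong₂ (λ b → zipWith _∨_ (map (b ∧_) x)) (h zero) (boolSum-cong L (h ∘ suc))

  byVector : (L : List V) → (Fin (length L) → Bool) → V → Bool
  byVector []      c v = false
  byVector (x ∷ L) c v = if does (v ≟ x) then c zero else byVector L (c ∘ suc) v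

  byVector-lookup : ∀ L c → Unique L → ∀ j → byVector L c (lookupˡ L j) ≡ c j
  byVector-lookup (x ∷ L) c _ zero with x ≟ x
  ... | yes _   = refl
  ... | no  x≢x = ⊥-elim (x≢x refl)
  byVector-lookup (x ∷ L) c (x∉L ∷ unique) (suc j) with lookupˡ L j ≟ x
  ... | yes eq = ⊥-elim (All.lookup x∉L (∈-lookup j) (sym eq))
  ... | no  _  = byVector-lookup L (c ∘ suc) unique j

  represents⇒InSpan : ∀ s {L f y} → Unique L → Represents s L f y → InSpan s L y
  represents⇒InSpan binary {L} {f} {y} unique rep = f ∘ lookupˡ L , lookup-ext λ i → begin
    lookup (binSum L (f ∘ lookupˡ L)) i  ≡⟨ lookup-binSum L f i ⟩
    count (selected f i) L              ≡⟨ AtMostOne⇒count≡b2n-any unique (rep .atMostOne i) ⟩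
    b2n (any (selected f i) L)          ≡⟨ cong b2n (rep .covers i) ⟩
    b2n (lookup y i)                    ≡⟨ lookup-map i b2n y ⟨
    lookup (map b2n y) i                ∎
  represents⇒InSpan boolean {L} {f} unique rep = f ∘ lookupˡ L , lookup-ext λ i →
    trans (lookup-boolSum L f i) (rep .covers i)

  InSpan⇒represents : ∀ s {L y} → Unique L → InSpan s L y → Σ (V → Bool) λ f → Represents s L f y
  InSpan⇒represents binary {L} {y} unique (c , sum≡y) =
    f , record { covers = covers′ ; atMostOne = atMostOne′ }
    where
    f : V → Bool
    f = byVector L c
    count≡y : ∀ i → count (selected f i) L ≡ b2n (lookup y i)
    count≡y i = begin
      count (selected f i) L              ≡⟨ lookup-binSum L f i ⟨
      lookup (binSum L (f ∘ lookupˡ L)) i  ≡⟨ cong (λ v → lookup v i) (binSum-cong L c≗f) ⟩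
      lookup (binSum L c) i               ≡⟨ cong (λ v → lookup v i) sum≡y ⟩
      lookup (map b2n y) i                ≡⟨ lookup-map i b2n y ⟩
      b2n (lookup y i)                    ∎
      where c≗f = byVector-lookup L c unique
    atMostOne′ : ∀ i → AtMostOne binary L (selected f i)
    atMostOne′ i = count≤1⇒AtMostOne L (subst (_≤ 1) (sym (count≡y i)) (b2n≤1 (lookup y i)))
    covers′ : ∀ i → any (selected f i) L ≡ lookup y i
    covers′ i =
      b2n-injective (trans (sym (AtMostOne⇒count≡b2n-any unique (atMostOne′ i))) (count≡y i))
  InSpan⇒represents boolean {L} unique (c , sum≡y) = byVector L c , record
    { covers    = λ i → trans (sym (lookup-boolSum L (byVector L c) i))
                        (cong (λ v → lookup v i) (trans (boolSum-cong L (byVector-lookup L c unique)) sum≡y))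
    ; atMostOne = λ _ → tt
    }

  choose-representations : ∀ {s L₁ L₂} → Unique L₁ → Spans s L₁ L₂ →
    Σ (V → V → Bool) λ H → ∀ {b} → b ∈ L₂ → Represents s L₁ (H b) b
  choose-representations {s} {L₁} {L₂} unique spans = (λ b → proj₁ (pick b (b ∈? L₂))) ,
                                                       λ {b} b∈L₂ → proj₂ (pick b (b ∈? L₂)) b∈L₂
    where
    pick : ∀ b → Dec (b ∈ L₂) → Σ (V → Bool) λ f → b ∈ L₂ → Represents s L₁ f b
    pick b (yes b∈L₂) = let (f , rep) = InSpan⇒represents s unique (spans b∈L₂) in f , λ _ → rep
    pick b (no  b∉L₂) = (λ _ → false) , λ b∈L₂ → ⊥-elim (b∉L₂ b∈L₂)

  composite : List V → (V → Bool) → (V → V → Bool) → V → Bool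
  composite L₂ g H x = any (λ b → g b ∧ H b x) L₂

  represents-trans : ∀ {s L₁ L₂ g H y} → Represents s L₂ g y →
                     (∀ {b} → b ∈ L₂ → Represents s L₁ (H b) b) →
                     Represents s L₁ (composite L₂ g H) y
  represents-trans {s} {L₁} {L₂} {g} {H} {y} g-rep H-rep = record
    { covers    = λ i → T-ext (covered i) (covering i)
    ; atMostOne = λ i → atMostOne′ s i (g-rep .atMostOne i) (λ b∈L₂ → H-rep b∈L₂ .atMostOne i)
    }
    where
    D : V → Bool
    D = composite L₂ g H

    through : ∀ i {x} → T (selected D i x) → ∃ λ b → b ∈ L₂ × T (g b) × T (H b x) × T (lookup x i)
    through i {x} sel with to T-∧ sel
    ... | Dx , xᵢ with any-elim (λ b → g b ∧ H b x) L₂ Dx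
    ... | b , b∈L₂ , gbHbx = b , b∈L₂ , proj₁ (to T-∧ gbHbx) , proj₂ (to T-∧ gbHbx) , xᵢ

    covered : ∀ i → T (any (selected D i) L₁) → T (lookup y i)
    covered i p with any-elim (selected D i) L₁ p
    ... | x , x∈L₁ , sel with through i sel
    ... | b , b∈L₂ , gb , Hbx , xᵢ =
      selected-below g-rep i b∈L₂ gb (selected-below (H-rep b∈L₂) i x∈L₁ Hbx xᵢ)

    covering : ∀ i → T (lookup y i) → T (any (selected D i) L₁)
    covering i yᵢ with any-elim (selected g i) L₂ (subst T (sym (g-rep .covers i)) yᵢ)
    ... | b , b∈L₂ , gbᵢ with to T-∧ gbᵢ
    ... | gb , bᵢ with any-elim (selected (H b) i) L₁ (subst T (sym (H-rep b∈L₂ .covers i)) bᵢ)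
    ... | x , x∈L₁ , Hbxᵢ with to T-∧ Hbxᵢ
    ... | Hbx , xᵢ = any-intro (selected D i) x∈L₁
                       (from T-∧ (any-intro (λ c → g c ∧ H c x) b∈L₂ (from T-∧ (gb , Hbx)) , xᵢ))

    atMostOne′ : ∀ s′ i → AtMostOne s′ L₂ (selected g i) →
                 (∀ {b} → b ∈ L₂ → AtMostOne s′ L₁ (selected (H b) i)) →
                 AtMostOne s′ L₁ (selected D i)
    atMostOne′ boolean _ _     _     = tt
    atMostOne′ binary  i g-amo H-amo {x} {x′} x∈L₁ x′∈L₁ sel sel′
      with through i sel | through i sel′
    ... | b , b∈L₂ , gb , Hbx , xᵢ | b′ , b′∈L₂ , gb′ , Hb′x′ , x′ᵢ =
      H-amo b∈L₂ x∈L₁ x′∈L₁ (from T-∧ (Hbx , xᵢ))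
        (from T-∧ (subst (λ c → T (H c x′)) (sym b≡b′) Hb′x′ , x′ᵢ))
      where
      b≡b′ : b ≡ b′
      b≡b′ = g-amo b∈L₂ b′∈L₂
        (from T-∧ (gb , selected-below (H-rep b∈L₂) i x∈L₁ Hbx xᵢ))
        (from T-∧ (gb′ , selected-below (H-rep b′∈L₂) i x′∈L₁ Hb′x′ x′ᵢ))

  composite-avoids : ∀ {s L₁ L₂ g H a} → a ∈ L₁ → ¬ a ∈ L₂ → Represents s L₂ g a →
                     (∀ {b} → b ∈ L₂ → Represents s L₁ (H b) b) → composite L₂ g H a ≡ false
  composite-avoids {L₂ = L₂} {g} {H} {a} a∈L₁ a∉L₂ g-rep H-rep = ¬T⇒≡false λ Da →
    let b , b∈L₂ , gbHba = any-elim (λ b → g b ∧ H b a) L₂ Da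
        gb , Hba = to T-∧ gbHba
        b≡a = support-antisym (λ i → selected-below g-rep i b∈L₂ gb)
                              (λ i → selected-below (H-rep b∈L₂) i a∈L₁ Hba)
    in a∉L₂ (subst (_∈ L₂) b≡a b∈L₂)

  substitute : V → (V → Bool) → (V → Bool) → V → Bool
  substitute a C D x = if does (x ≟ a) then false else C x ∨ D x

  substitute-self : ∀ a C D → substitute a C D a ≡ false
  substitute-self a C D with a ≟ a
  ... | yes _   = refl
  ... | no  a≢a = ⊥-elim (a≢a refl)

  substitute-other : ∀ {a x} C D → x ≢ a → substitute a C D x ≡ C x ∨ D x
  substitute-other {a} {x} C D x≢a with x ≟ a
  ... | yes x≡a = ⊥-elim (x≢a x≡a)
  ... | no  _   = refl

  substitute-represents : ∀ {s L a C D y} → a ∈ L → Represents s L D a → D a ≡ false →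
                          Represents s L C y → T (C a) → Represents s L (substitute a C D) y
  substitute-represents {s} {L} {a} {C} {D} {y} a∈L D-rep Da≡false C-rep Ca = record
    { covers    = covers′
    ; atMostOne = λ i → atMostOne′ s i (C-rep .atMostOne i) (D-rep .atMostOne i)
    }
    where
    F : V → Bool
    F = substitute a C D

    agree : ∀ i → lookup a i ≡ false → ∀ {x} → x ∈ L → selected F i x ≡ selected C i x
    agree i aᵢ {x} x∈L with x ≟ a
    ... | yes refl = sym (trans (cong (C a ∧_) aᵢ) (∧-zeroʳ (C a)))
    ... | no  _    = begin
      (C x ∨ D x) ∧ lookup x i                ≡⟨ ∧-distribʳ-∨ (lookup x i) (C x) (D x) ⟩
      selected C i x ∨ selected D i x         ≡⟨ cong (selected C i x ∨_) Dxᵢ≡false ⟩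
      selected C i x ∨ false                  ≡⟨ ∨-identityʳ _ ⟩
      selected C i x                          ∎
      where
      Dxᵢ≡false : selected D i x ≡ false
      Dxᵢ≡false = ¬T⇒≡false (any-false (selected D i) (trans (D-rep .covers i) aᵢ) x∈L)

    covering : ∀ i → T (lookup a i) → T (any (selected F i) L)
    covering i aᵢ with any-elim (selected D i) L (subst T (sym (D-rep .covers i)) aᵢ)
    ... | x , x∈L , Dxᵢ with to (T-∧ {D x}) Dxᵢ | x ≟ a
    ... | Dx , _  | yes refl = ⊥-elim (subst T Da≡false Dx)
    ... | Dx , xᵢ | no  x≢a  = any-intro (selected F i) x∈L
      (subst (λ b → T (b ∧ lookup x i)) (sym (substitute-other C D x≢a))
             (from (T-∧ {C x ∨ D x}) (from (T-∨ {C x}) (inj₂ Dx) , xᵢ)))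

    covers′ : ∀ i → any (selected F i) L ≡ lookup y i
    covers′ i with lookup a i in aᵢ
    ... | false = trans (any-cong L (agree i aᵢ)) (C-rep .covers i)
    ... | true  = T-ext (λ _ → selected-below C-rep i a∈L Ca (subst T (sym aᵢ) tt))
                        (λ _ → covering i (subst T (sym aᵢ) tt))

    atMostOne′ : ∀ s′ i → AtMostOne s′ L (selected C i) → AtMostOne s′ L (selected D i) →
                 AtMostOne s′ L (selected F i)
    atMostOne′ boolean _ _     _     = tt
    atMostOne′ binary  i C-amo D-amo with lookup a i in aᵢ
    ... | false = AtMostOne-mono binary id (λ x∈L → subst T (agree i aᵢ x∈L)) C-amo
    ... | true  = AtMostOne-mono binary id F⇒D D-amo
      where
      -- The only vector C selects in coordinate i is a itself.
      F⇒D : ∀ {x} → x ∈ L → T (selected F i x) → T (selected D i x)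
      F⇒D {x} x∈L sel with x ≟ a
      ... | yes refl = ⊥-elim sel
      ... | no  x≢a with to (T-∧ {C x ∨ D x}) sel
      ... | CxDx , xᵢ with to (T-∨ {C x}) CxDx
      ... | inj₁ Cx = ⊥-elim (x≢a (C-amo x∈L a∈L (from (T-∧ {C x}) (Cx , xᵢ))
                                                 (from (T-∧ {C a}) (Ca , subst T (sym aᵢ) tt))))
      ... | inj₂ Dx = from (T-∧ {D x}) (Dx , xᵢ)

  eliminate : ∀ {s L a C D y} → a ∈ L → Represents s L D a → D a ≡ false →
              Represents s L C y → Σ (V → Bool) λ F → F a ≡ false × Represents s L F y
  eliminate {a = a} {C} {D} a∈L D-rep Da≡false C-rep with C a in Ca
  ... | false = C , Ca , C-rep
  ... | true  = substitute a C D , substitute-self a C D ,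
                substitute-represents a∈L D-rep Da≡false C-rep (subst T (sym Ca) tt)

  represents-without : ∀ {s L f y a} → f a ≡ false → Represents s L f y →
                       Represents s (without a L) f y
  represents-without {s} {L} {a = a} fa rep = record
    { covers    = λ i → trans (any-without L (cong (_∧ lookup a i) fa)) (rep .covers i)
    ; atMostOne = λ i → AtMostOne-mono s (proj₁ ∘ ∈-filter⁻ _) (λ _ → id) (rep .atMostOne i)
    }

  base-element-irredundant : ∀ {s m} {A : Fin m → V} {B a D} → IsBase s A B → a ∈ B →
                             Represents s B D a → D a ≡ false → ⊥
  base-element-irredundant {s} {A = A} {B} {a} (unique , spans , minimal) a∈B D-rep Da≡false =
    <⇒≱ (filter-notAll _ B (lose a∈B λ a≢a → a≢a refl))
        (minimal (without a B) unique′ spans′)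
    where
    unique′ : Unique (without a B)
    unique′ = filter⁺ _ unique
    spans′ : SpansColumns s A (without a B)
    spans′ j with InSpan⇒represents s unique (spans j)
    ... | C , C-rep with eliminate a∈B D-rep Da≡false C-rep
    ... | F , Fa , F-rep = represents⇒InSpan s unique′ (represents-without Fa F-rep)

  spansAllBases-∈ : ∀ {s m} {A : Fin m → V} {B₁ B₂ a} →
                    SpansAllBases s A B₁ → SpansAllBases s A B₂ → a ∈ B₁ → a ∈ B₂
  spansAllBases-∈ {s} {B₁ = B₁} {B₂} {a} (base₁ , spans₁) (base₂ , spans₂) a∈B₁
    with InSpan⇒represents s (proj₁ base₂) (spans₂ B₁ base₁ a∈B₁)
       | choose-representations (proj₁ base₁) (spans₁ B₂ base₂)
  ... | g , g-rep | H , H-rep = decidable-stable (a ∈? B₂) λ a∉B₂ →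
    base-element-irredundant base₁ a∈B₁ (represents-trans g-rep H-rep)
                             (composite-avoids a∈B₁ a∉B₂ g-rep H-rep)

mainTheorem12 : (s : Setting) (n m : ℕ) (A : Fin m → Vec Bool n)
    (B₁ B₂ : List (Vec Bool n)) →
    SpansAllBases s A B₁ → SpansAllBases s A B₂ →
    ∀ (v : Vec Bool n) → (v ∈ B₁ → v ∈ B₂) × (v ∈ B₂ → v ∈ B₁)
mainTheorem12 s n m A B₁ B₂ all₁ all₂ v = spansAllBases-∈ all₁ all₂ , spansAllBases-∈ all₂ all₁
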